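{- No vector $(x_\alpha,\ldots,x_1)$ with $\alpha\ge3$ and $x_{\alpha-2}=1$ is realizable.
   Context: All graphs are finite, nonempty, simple and reflexive. Corner ranking: $N[v]$ is the closed neighborhood. In a graph $H$, $w$ strictly corners a distinct vertex $v$ if $N[v]\subsetneq N[w]$. Set $G^{(1)}=G$, $k=1$. If $G^{(k)}$ is a clique, give its vertices rank $k$ and stop; else if it has no strict corners, give its vertices rank $\infty$ and stop; else give all strict corners of $G^{(k)}$ rank $k$, delete them to get $G^{(k+1)}$, increase $k$, repeat. The corner rank $\alpha$ is the largest vertex rank; cop-win graphs are those with finite corner rank. The rank cardinality vector of $G$ is $(x_\alpha,\ldots,x_1)$, $x_k$ the number of vertices of rank $k$. A vector of positive integers is realizable if it is the rank cardinality vector of some cop-win graph. -}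

module Defs where

open import Data.Nat using (ℕ; zero; suc; _≤_; _⊔_)
open import Data.Bool using (Bool; true; false; _∧_; _∨_; not; if_then_else_; T)
open import Data.Fin using (Fin; _≟_)
open import Data.Fin.Base using () 
open import Data.List using (List; []; _∷_; map; foldr; length; filter; downFrom)
open import Data.Bool.ListAction using (all; any)
open import Data.List.Base using (allFin)
open import Data.Maybe using (Maybe; just; nothing; Is-just)
open import Data.Product using (Σ; _×_; ∃)
open import Relation.Nullary.Decidable using (⌊_⌋)
open import Relation.Binary.PropositionalEquality using (_≡_)

-- Simple: adjacency is a Bool-valued symmetric relation (no multi-edges);
-- reflexive: every vertex is adjacent to itself (closed neighbourhoods).
record Graph : Set where
  field
    n        : ℕ
    nonempty : 1 ≤ n
    adj      : Fin n → Fin n → Bool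
    adj-refl : ∀ v → adj v v ≡ true
    adj-sym  : ∀ u v → adj u v ≡ adj v u

open Graph public

-- A set of vertices of Fin n (the current vertex set of G^(k)).
VSet : ℕ → Set
VSet n = Fin n → Bool

module _ (G : Graph) where
  private
    V = Fin (n G)
    vs : List V
    vs = allFin (n G)

  nbhdSub : VSet (n G) → V → V → Bool
  nbhdSub S v w = all (λ u → not (S u ∧ adj G v u) ∨ adj G w u) vs

  strictlyCorners : VSet (n G) → V → V → Bool
  strictlyCorners S w v =
    S v ∧ S w ∧ not ⌊ v ≟ w ⌋ ∧ nbhdSub S v w ∧ not (nbhdSub S w v)

  isStrictCorner : VSet (n G) → V → Bool
  isStrictCorner S v = any (λ w → strictlyCorners S w v) vs

  isClique : VSet (n G) → Bool
  isClique S = all (λ u → all (λ v → not (S u ∧ S v) ∨ adj G u v) vs) vs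

  hasStrictCorner : VSet (n G) → Bool
  hasStrictCorner S = any (isStrictCorner S) vs

  -- ranks: just k = rank k, nothing = rank ∞
  -- rankFrom fuel k S v : rank of v when the current graph is G^(k) = G[S].
  -- (fuel n suffices: each round deletes at least one vertex.)
  rankFrom : ℕ → ℕ → VSet (n G) → V → Maybe ℕ
  rankFrom zero k S v = nothing
  rankFrom (suc fuel) k S v =
    if isClique S then just k
    else if not (hasStrictCorner S) then nothing
    else if isStrictCorner S v then just k
    else rankFrom fuel (suc k) (λ u → S u ∧ not (isStrictCorner S u)) v

  rank : V → Maybe ℕ
  rank v = rankFrom (n G) 1 (λ _ → true) v

  CopWin : Set
  CopWin = ∀ v → Is-just (rank v)

  finRank : Maybe ℕ → ℕ
  finRank (just k) = k
  finRank nothing  = 0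

  cornerRank : ℕ
  cornerRank = foldr (λ v m → finRank (rank v) ⊔ m) 0 vs

  hasRank : ℕ → V → Bool
  hasRank k v with rank v
  ... | just j  = ⌊ Data.Nat._≟_ j k ⌋
  ... | nothing = false

  rankCount : ℕ → ℕ
  rankCount k = length (filter (λ v → T? (hasRank k v)) vs)
    where
    open import Data.Bool.Properties using (T?)

  rankCardinalityVector : List ℕ
  rankCardinalityVector = map (λ i → rankCount (suc i)) (downFrom cornerRank)

Realizable : List ℕ → Set
Realizable xs = Σ Graph λ G → CopWin G × rankCardinalityVector G ≡ xs

-- Let G be cop-win of corner rank α = m+3, and let H = G^(m+1), H' = G^(m+2),
-- K = G^(m+3) be the last three graphs of the corner-ranking procedure.
-- Since x_(m+1) = 1, H has a unique strict corner v, so H' = H - v; since every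
-- rank is at most α and some vertex has rank α, K is a clique; and since
-- x_(m+2) ≥ 1, H' has a strict corner.  The combinatorial heart of the proof
-- (module UniqueCorner) shows that these three facts are incompatible: a
-- vertex w₀ cornering v and a maximal dominator k of w₀ in H' force either a
-- strict corner y of H' or k itself to be a second strict corner of H.
module Submission where

open import Defs
open import Data.Nat using (ℕ; _≤_)
open import Data.List using (List; _∷_)
open import Data.List.Relation.Unary.All using (All)
open import Relation.Nullary using (¬_)

open import Data.Nat using (zero; suc; _<_; _+_; _⊔_; s≤s; z≤n) renaming (_≟_ to _≟ℕ_)
open import Data.Nat.Properties
  using (<-trans; <⇒≱; ≤-trans; ≤-refl; <⇒≤; m≤n⇒m≤1+n; <-irrefl; ≤⇒≯; n<1+n; m<n+m; m≤m⊔n; m≤n⊔m)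
open import Data.Bool using (Bool; true; false; _∧_; _∨_; not; T)
open import Data.Bool.Properties using (T-∧; T-≡; T-not-≡)
open import Data.Fin using (Fin; _≟_)
open import Data.List using ([]; filter; length; foldr; allFin; downFrom; map)
open import Data.List.Membership.Propositional using (_∈_; lose)
open import Data.List.Membership.Propositional.Properties using (∈-allFin; ∈-filter⁺; ∈-filter⁻)
open import Data.List.Relation.Unary.Any using (here; there; satisfied)
import Data.List.Relation.Unary.All as All
open import Data.List.Relation.Unary.All.Properties using (all⁺; all⁻; ¬All⇒Any¬)
open import Data.List.Relation.Unary.Any.Properties using (any⁺; any⁻)
open import Data.List.Extrema.Nat using (argmax; argmax-all; f[xs]≤f[argmax])
open import Data.Maybe using (just; nothing)
open import Data.Product using (Σ; _×_; _,_; proj₁; proj₂)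
open import Data.Sum using (_⊎_; inj₁; inj₂)
open import Data.Empty using (⊥)
open import Function using (_∘_; Equivalence)
open import Relation.Nullary using (Dec; yes; no; contradiction)
open import Relation.Nullary.Decidable using (T?; ⌊_⌋; toWitnessFalse; fromWitnessFalse)
open import Relation.Unary using (Pred; Decidable)
open import Level using (0ℓ)
open import Relation.Binary.PropositionalEquality using (_≡_; _≢_; refl; sym; trans; subst)

∧-split : ∀ {x y} → T (x ∧ y) → T x × T y
∧-split = Equivalence.to T-∧

∧-join : ∀ {x y} → T x → T y → T (x ∧ y)
∧-join p q = Equivalence.from T-∧ (p , q)

not-sound : ∀ {x} → T (not x) → ¬ T x
not-sound {false} _ ()

not-complete : ∀ {x} → ¬ T x → T (not x)
not-complete {false} _ = _
not-complete {true}  h = h _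

¬T⇒false : ∀ {x} → ¬ T x → x ≡ false
¬T⇒false = Equivalence.to T-not-≡ ∘ not-complete

T⇒true : ∀ {x} → T x → x ≡ true
T⇒true = Equivalence.to T-≡

clause-sound : ∀ x y z → T (not (x ∧ y) ∨ z) → T x → T y → T z
clause-sound true true _ h _ _ = h

clause-complete : ∀ x y z → (T x → T y → T z) → T (not (x ∧ y) ∨ z)
clause-complete false _    _ _ = _
clause-complete true  false _ _ = _
clause-complete true  true  _ h = h _ _

clause-refute : ∀ x y z → ¬ T (not (x ∧ y) ∨ z) → T x × T y × ¬ T z
clause-refute false _     _ h = contradiction _ h
clause-refute true  false _ h = contradiction _ h
clause-refute true  true  _ h = _ , _ , h

module _ {A : Set} {P : Pred A 0ℓ} (P? : Decidable P) where

  filter-witness : (xs : List A) → 1 ≤ length (filter P? xs) → Σ A P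
  filter-witness xs h with filter P? xs in eq
  ... | x ∷ _ = x , proj₂ (∈-filter⁻ P? {xs = xs} (subst (x ∈_) (sym eq) (here refl)))

  filter-singleton : (xs : List A) → length (filter P? xs) ≡ 1 →
                     ∀ {x y} → x ∈ xs → y ∈ xs → P x → P y → x ≡ y
  filter-singleton xs h x∈ y∈ px py = singleton h (∈-filter⁺ P? x∈ px) (∈-filter⁺ P? y∈ py)
    where
    singleton : ∀ {zs : List A} {x y} → length zs ≡ 1 → x ∈ zs → y ∈ zs → x ≡ y
    singleton {_ ∷ []} _ (here refl) (here refl) = refl

module _ {A : Set} {P Q : Pred A 0ℓ} (P? : Decidable P) (Q? : Decidable Q)
         (P⇒Q : ∀ {x} → P x → Q x) where

  filter-length-≤ : (xs : List A) → length (filter P? xs) ≤ length (filter Q? xs)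
  filter-length-≤ [] = z≤n
  filter-length-≤ (x ∷ xs) with P? x | Q? x
  ... | yes px | no ¬qx = contradiction (P⇒Q px) ¬qx
  ... | yes _  | yes _  = s≤s (filter-length-≤ xs)
  ... | no _   | yes _  = m≤n⇒m≤1+n (filter-length-≤ xs)
  ... | no _   | no _   = filter-length-≤ xs

  filter-length-< : (xs : List A) → ∀ {z} → z ∈ xs → Q z → ¬ P z →
                    length (filter P? xs) < length (filter Q? xs)
  filter-length-< (x ∷ xs) z∈ qz ¬pz with P? x | Q? x
  ... | yes px | no ¬qx = contradiction (P⇒Q px) ¬qx
  filter-length-< (x ∷ xs) (here refl) qz ¬pz | yes px | _     = contradiction px ¬pz
  filter-length-< (x ∷ xs) (here refl) qz ¬pz | no _   | yes _ = s≤s (filter-length-≤ xs)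
  filter-length-< (x ∷ xs) (here refl) qz ¬pz | no _ | no ¬qz = contradiction qz ¬qz
  filter-length-< (x ∷ xs) (there z∈) qz ¬pz | yes _ | yes _ =
    s≤s (filter-length-< xs z∈ qz ¬pz)
  filter-length-< (x ∷ xs) (there z∈) qz ¬pz | no _ | yes _ =
    m≤n⇒m≤1+n (filter-length-< xs z∈ qz ¬pz)
  filter-length-< (x ∷ xs) (there z∈) qz ¬pz | no _ | no _ =
    filter-length-< xs z∈ qz ¬pz

module _ (G : Graph) where

  private
    V : Set
    V = Fin (n G)

    vertices : List V
    vertices = allFin (n G)

  _~_ : V → V → Set
  a ~ b = T (adj G a b)

  ~-refl : ∀ a → a ~ a
  ~-refl a = subst T (sym (adj-refl G a)) _

  ~-sym : ∀ {a b} → a ~ b → b ~ a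
  ~-sym {a} {b} = subst T (adj-sym G a b)

  NbhdSub : VSet (n G) → V → V → Set
  NbhdSub S a b = ∀ u → T (S u) → a ~ u → b ~ u

  record StrictlyCorners (S : VSet (n G)) (w c : V) : Set where
    field
      c∈S     : T (S c)
      w∈S     : T (S w)
      c≢w     : c ≢ w
      smaller : NbhdSub S c w
      extra   : V
      extra∈S : T (S extra)
      w~extra : w ~ extra
      c≁extra : ¬ c ~ extra

  Universal : VSet (n G) → V → Set
  Universal S k = ∀ z → T (S z) → k ~ z

  clause : VSet (n G) → V → V → V → Bool
  clause S a b u = not (S u ∧ adj G a u) ∨ adj G b u

  nbhdSub-sound : ∀ S a b → T (nbhdSub G S a b) → NbhdSub S a b
  nbhdSub-sound S a b h u u∈S a~u =
    clause-sound (S u) (adj G a u) (adj G b u)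
      (All.lookup (all⁺ (clause S a b) vertices h) (∈-allFin u)) u∈S a~u

  nbhdSub-complete : ∀ S a b → NbhdSub S a b → T (nbhdSub G S a b)
  nbhdSub-complete S a b h = all⁻ (clause S a b) {xs = vertices}
    (All.tabulate (λ {u} _ → clause-complete (S u) (adj G a u) (adj G b u) (h u)))

  nbhdSub-refute : ∀ S a b → ¬ T (nbhdSub G S a b) → Σ V λ u → T (S u) × a ~ u × ¬ b ~ u
  nbhdSub-refute S a b h
    with satisfied (¬All⇒Any¬ (T? ∘ clause S a b) vertices (h ∘ all⁻ (clause S a b)))
  ... | u , ¬clause = u , clause-refute (S u) (adj G a u) (adj G b u) ¬clause

  strictlyCorners-sound : ∀ S w c → T (strictlyCorners G S w c) → StrictlyCorners S w c
  strictlyCorners-sound S w c h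
    with c∈S , h₁ ← ∧-split {S c} h
    with w∈S , h₂ ← ∧-split {S w} h₁
    with c≢w , h₃ ← ∧-split {not ⌊ c ≟ w ⌋} h₂
    with sub , nsub ← ∧-split {nbhdSub G S c w} h₃
    with u , u∈S , w~u , c≁u ← nbhdSub-refute S w c (not-sound nsub)
    = record { c∈S = c∈S ; w∈S = w∈S ; c≢w = toWitnessFalse {a? = c ≟ w} c≢w
             ; smaller = nbhdSub-sound S c w sub
             ; extra = u ; extra∈S = u∈S ; w~extra = w~u ; c≁extra = c≁u }

  strictlyCorners-complete : ∀ S w c → StrictlyCorners S w c → T (strictlyCorners G S w c)
  strictlyCorners-complete S w c d =
    ∧-join c∈S (∧-join w∈S (∧-join (fromWitnessFalse {a? = c ≟ w} c≢w)
      (∧-join (nbhdSub-complete S c w smaller) (not-complete not-larger))))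
    where
    open StrictlyCorners d
    not-larger : ¬ T (nbhdSub G S w c)
    not-larger h = c≁extra (nbhdSub-sound S w c h extra extra∈S w~extra)

  corner-sound : ∀ S c → T (isStrictCorner G S c) → Σ V λ w → StrictlyCorners S w c
  corner-sound S c h with w , p ← satisfied (any⁻ _ vertices h) = w , strictlyCorners-sound S w c p

  corner-complete : ∀ S w c → StrictlyCorners S w c → T (isStrictCorner G S c)
  corner-complete S w c d = any⁺ _ (lose (∈-allFin w) (strictlyCorners-complete S w c d))

  has-corner-sound : ∀ S → T (hasStrictCorner G S) → Σ V λ c → T (isStrictCorner G S c)
  has-corner-sound S h = satisfied (any⁻ _ vertices h)

  clique-sound : ∀ S → T (isClique G S) → ∀ a b → T (S a) → T (S b) → a ~ b
  clique-sound S h a b a∈S b∈S =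
    clause-sound (S a) (S b) (adj G a b)
      (All.lookup (all⁺ _ vertices (All.lookup (all⁺ _ vertices h) (∈-allFin a))) (∈-allFin b))
      a∈S b∈S

  step : VSet (n G) → VSet (n G)
  step S u = S u ∧ not (isStrictCorner G S u)

  step-⊆ : ∀ S {u} → T (step S u) → T (S u)
  step-⊆ S {u} h = proj₁ (∧-split {S u} h)

  step-not-corner : ∀ S {u} → T (step S u) → ¬ T (isStrictCorner G S u)
  step-not-corner S {u} h = not-sound (proj₂ (∧-split {S u} h))

  step-survivor : ∀ S {u} → T (S u) → ¬ T (isStrictCorner G S u) → T (step S u)
  step-survivor S u∈S nc = ∧-join u∈S (not-complete nc)

  step-split : ∀ S u → T (S u) → T (step S u) ⊎ T (isStrictCorner G S u)
  step-split S u u∈S with T? (isStrictCorner G S u)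
  ... | yes c = inj₂ c
  ... | no nc = inj₁ (step-survivor S u∈S nc)

  degree : VSet (n G) → V → ℕ
  degree S x = length (filter (λ u → T? (S u ∧ adj G x u)) vertices)

  corner-degree-< : ∀ S w c → StrictlyCorners S w c → degree S c < degree S w
  corner-degree-< S w c d =
    filter-length-< (λ u → T? (S u ∧ adj G c u)) (λ u → T? (S u ∧ adj G w u)) c⇒w
      vertices (∈-allFin extra) (∧-join extra∈S w~extra) (c≁extra ∘ proj₂ ∘ ∧-split {S extra})
    where
    open StrictlyCorners d
    c⇒w : ∀ {u} → T (S u ∧ adj G c u) → T (S u ∧ adj G w u)
    c⇒w {u} h with u∈S , c~u ← ∧-split {S u} h = ∧-join u∈S (smaller u u∈S c~u)

  -- A dominator of a of maximal degree among all dominators of a in G[S] is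
  -- not a strict corner: whatever cornered it would dominate a with larger degree.
  maximal-not-corner : ∀ S a k → NbhdSub S a k →
                       (∀ w → T (S w) → NbhdSub S a w → degree S w ≤ degree S k) →
                       ¬ T (isStrictCorner G S k)
  maximal-not-corner S a k a⊆k maximal k-corner =
    ≤⇒≯ (maximal w w∈S (λ u u∈S a~u → smaller u u∈S (a⊆k u u∈S a~u))) (corner-degree-< S w k d)
    where
    w : V
    w = proj₁ (corner-sound S k k-corner)
    d : StrictlyCorners S w k
    d = proj₂ (corner-sound S k k-corner)
    open StrictlyCorners d

  -- Every vertex a of G[S] is dominated (N[a] ⊆ N[k]) by a vertex k of G[S]
  -- that is not a strict corner: any dominator of a of maximal degree will do.
  maximal-dominator : ∀ S a → T (S a) →
                      Σ V λ k → T (S k) × NbhdSub S a k × ¬ T (isStrictCorner G S k)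
  maximal-dominator S a a∈S =
    k , proj₁ k-dominates , proj₂ k-dominates , maximal-not-corner S a k (proj₂ k-dominates) maximal
    where
    Dominates : V → Set
    Dominates k = T (S k) × NbhdSub S a k

    dominates? : (k : V) → Dec (T (S k ∧ nbhdSub G S a k))
    dominates? k = T? (S k ∧ nbhdSub G S a k)

    dominators : List V
    dominators = filter dominates? vertices

    k : V
    k = argmax (degree S) a dominators

    k-dominates : Dominates k
    k-dominates = argmax-all (degree S) {P = Dominates} (a∈S , λ _ _ a~u → a~u)
                    (All.tabulate (λ k∈ → read (proj₂ (∈-filter⁻ dominates? {xs = vertices} k∈))))
      where
      read : ∀ {k} → T (S k ∧ nbhdSub G S a k) → Dominates k
      read {k} h with k∈S , sub ← ∧-split {S k} h = k∈S , nbhdSub-sound S a k sub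

    maximal : ∀ w → T (S w) → NbhdSub S a w → degree S w ≤ degree S k
    maximal w w∈S a⊆w = All.lookup (f[xs]≤f[argmax] {f = degree S} a dominators)
      (∈-filter⁺ dominates? (∈-allFin w) (∧-join w∈S (nbhdSub-complete S a w a⊆w)))

  universal-corners : ∀ S k c z → Universal S k → T (S k) → T (S c) → T (S z) → ¬ c ~ z →
                      StrictlyCorners S k c
  universal-corners S k c z univ k∈S c∈S z∈S c≁z = record
    { c∈S = c∈S ; w∈S = k∈S ; c≢w = λ { refl → c≁z (univ z z∈S) }
    ; smaller = λ u u∈S _ → univ u u∈S
    ; extra = z ; extra∈S = z∈S ; w~extra = univ z z∈S ; c≁extra = c≁z }

  corner-lift : ∀ S S' w c → (∀ {z} → T (S' z) → T (S z)) →
                (∀ z → T (S z) → c ~ z → T (S' z)) →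
                StrictlyCorners S' w c → StrictlyCorners S w c
  corner-lift S S' w c S'⊆S local d = record
    { c∈S = S'⊆S c∈S ; w∈S = S'⊆S w∈S ; c≢w = c≢w
    ; smaller = λ u u∈S c~u → smaller u (local u u∈S c~u) c~u
    ; extra = extra ; extra∈S = S'⊆S extra∈S ; w~extra = w~extra ; c≁extra = c≁extra }
    where open StrictlyCorners d

  -- Take a vertex w₀ cornering v in G[H] and a maximal dominator k of
  -- w₀ in G[H']; k is universal in G[H'].  If k ~ v, k is universal in G[H] and
  -- strictly corners any strict corner y of G[H']; if k ≁ v, then w₀ strictly
  -- corners k in G[H].  Either way G[H] gets a second strict corner.
  module UniqueCorner (H : VSet (n G)) (v : V) (v-corner : T (isStrictCorner G H v))
                      (unique : ∀ c → T (isStrictCorner G H c) → c ≡ v)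
                      (K-clique : T (isClique G (step (step H)))) where

    private
      H' K : VSet (n G)
      H' = step H
      K = step H'

    H-split : ∀ z → T (H z) → z ≡ v ⊎ T (H' z)
    H-split z z∈H with step-split H z z∈H
    ... | inj₁ z∈H'     = inj₂ z∈H'
    ... | inj₂ z-corner = inj₁ (unique z z-corner)

    survivor-not-corner : ∀ c → T (H' c) → ¬ T (isStrictCorner G H c)
    survivor-not-corner c c∈H' c-corner =
      step-not-corner H (subst (T ∘ H') (unique c c-corner) c∈H') v-corner

    -- Every strict corner of G[H'] is adjacent to v; otherwise its
    -- neighbourhood lies in H' and the cornering lifts to G[H].
    corner-adjacent-v : ∀ u → T (isStrictCorner G H' u) → u ~ v
    corner-adjacent-v u u-corner with T? (adj G u v)
    ... | yes u~v = u~v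
    ... | no u≁v = contradiction (corner-complete H w u (corner-lift H H' w u (step-⊆ H) local d))
                                 (survivor-not-corner u (StrictlyCorners.c∈S d))
      where
      w : V
      w = proj₁ (corner-sound H' u u-corner)
      d : StrictlyCorners H' w u
      d = proj₂ (corner-sound H' u u-corner)
      local : ∀ z → T (H z) → u ~ z → T (H' z)
      local z z∈H u~z with H-split z z∈H
      ... | inj₁ refl = contradiction u~z u≁v
      ... | inj₂ z∈H' = z∈H'

    w₀ : V
    w₀ = proj₁ (corner-sound H v v-corner)

    w₀-corners-v : StrictlyCorners H w₀ v
    w₀-corners-v = proj₂ (corner-sound H v v-corner)

    open StrictlyCorners w₀-corners-v using () renaming (w∈S to w₀∈H; smaller to v⊆w₀)

    w₀∈H' : T (H' w₀)
    w₀∈H' with H-split w₀ w₀∈H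
    ... | inj₁ w₀≡v = contradiction (sym w₀≡v) (StrictlyCorners.c≢w w₀-corners-v)
    ... | inj₂ w₀∈H' = w₀∈H'

    w₀~v : w₀ ~ v
    w₀~v = v⊆w₀ v (StrictlyCorners.c∈S w₀-corners-v) (~-refl v)

    w₀~corner : ∀ u → T (isStrictCorner G H' u) → w₀ ~ u
    w₀~corner u u-corner =
      v⊆w₀ u (step-⊆ H (StrictlyCorners.c∈S (proj₂ (corner-sound H' u u-corner))))
              (~-sym (corner-adjacent-v u u-corner))

    module _ (k : V) (k∈K : T (K k)) (w₀⊆k : NbhdSub H' w₀ k) where

      private
        k∈H' : T (H' k)
        k∈H' = step-⊆ H' k∈K

      -- k sees the strict corners of G[H'] through w₀ and the rest of H', which
      -- is K, because K is a clique.
      k-universal : Universal H' k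
      k-universal z z∈H' with step-split H' z z∈H'
      ... | inj₁ z∈K      = clique-sound K K-clique k z k∈K z∈K
      ... | inj₂ z-corner = w₀⊆k z z∈H' (w₀~corner z z-corner)

      -- Hence every vertex of K is universal in G[H']: a non-universal one
      -- would be strictly cornered by k.
      K-universal : ∀ k' → T (K k') → Universal H' k'
      K-universal k' k'∈K z z∈H' with T? (adj G k' z)
      ... | yes k'~z = k'~z
      ... | no k'≁z = contradiction
          (corner-complete H' k k'
            (universal-corners H' k k' z k-universal k∈H' (step-⊆ H' k'∈K) z∈H' k'≁z))
          (step-not-corner H' k'∈K)

      k-universal-H : k ~ v → Universal H k
      k-universal-H k~v z z∈H with H-split z z∈H
      ... | inj₁ refl = k~v
      ... | inj₂ z∈H' = k-universal z z∈H'

      -- If k ≁ v, then w₀ strictly corners k in G[H], with v as the extra neighbour.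
      w₀-corners-k : ¬ k ~ v → StrictlyCorners H w₀ k
      w₀-corners-k k≁v = record
        { c∈S = step-⊆ H k∈H' ; w∈S = w₀∈H ; c≢w = λ k≡w₀ → k≁v (subst (_~ v) (sym k≡w₀) w₀~v)
        ; smaller = k⊆w₀ ; extra = v ; extra∈S = StrictlyCorners.c∈S w₀-corners-v
        ; w~extra = w₀~v ; c≁extra = k≁v }
        where
        k⊆w₀ : NbhdSub H k w₀
        k⊆w₀ z z∈H k~z with H-split z z∈H
        ... | inj₁ refl = contradiction k~z k≁v
        ... | inj₂ z∈H' with step-split H' z z∈H'
        ...   | inj₁ z∈K      = ~-sym (K-universal z z∈K w₀ w₀∈H')
        ...   | inj₂ z-corner = w₀~corner z z-corner

      second-corner : ∀ y → ¬ T (isStrictCorner G H' y)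
      second-corner y y-corner with T? (adj G k v)
      ... | yes k~v = survivor-not-corner y y∈H'
            (corner-complete H k y (universal-corners H k y extra (k-universal-H k~v)
              (step-⊆ H k∈H') (step-⊆ H y∈H') (step-⊆ H extra∈S) c≁extra))
        where
        open StrictlyCorners (proj₂ (corner-sound H' y y-corner)) renaming (c∈S to y∈H')
      ... | no k≁v = survivor-not-corner k k∈H' (corner-complete H w₀ k (w₀-corners-k k≁v))

    -- A maximal dominator of w₀ in G[H'] is not a strict corner of G[H'], so it lies in K.
    no-corner : ∀ y → ¬ T (isStrictCorner G H' y)
    no-corner =
      let k , k∈H' , w₀⊆k , k-survives = maximal-dominator H' w₀ w₀∈H'
      in second-corner k (step-survivor H' k∈H' k-survives) w₀⊆k

  -- G[S] is neither a clique nor free of strict corners, so the ranking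
  -- procedure performs a round on it.
  record Proper (S : VSet (n G)) : Set where
    field
      notClique : ¬ T (isClique G S)
      hasCorner : T (hasStrictCorner G S)

  rank-corner : ∀ f k S c → Proper S → T (isStrictCorner G S c) →
                rankFrom G (suc f) k S c ≡ just k
  rank-corner f k S c p c-corner
    rewrite ¬T⇒false (Proper.notClique p) | T⇒true (Proper.hasCorner p) | T⇒true c-corner = refl

  rank-survivor : ∀ f k S c → Proper S → ¬ T (isStrictCorner G S c) →
                  rankFrom G (suc f) k S c ≡ rankFrom G f (suc k) (step S) c
  rank-survivor f k S c p c-survives
    rewrite ¬T⇒false (Proper.notClique p) | T⇒true (Proper.hasCorner p) | ¬T⇒false c-survives = refl

  rank-stuck : ∀ f k S c → ¬ T (isClique G S) → ¬ T (hasStrictCorner G S) →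
               rankFrom G f k S c ≡ nothing
  rank-stuck zero    k S c _ _ = refl
  rank-stuck (suc f) k S c ncl nhc rewrite ¬T⇒false ncl | ¬T⇒false nhc = refl

  rank-≥ : ∀ f k S c {r} → rankFrom G f k S c ≡ just r → k ≤ r
  rank-≥ (suc f) k S c h with isClique G S | hasStrictCorner G S | isStrictCorner G S c | h
  ... | true  | _     | _     | refl = ≤-refl
  ... | false | true  | true  | refl = ≤-refl
  ... | false | true  | false | h'   = <⇒≤ (rank-≥ f (suc k) _ c h')

  rank-later : ∀ f k S c {r} → Proper S → ¬ T (isStrictCorner G S c) →
               rankFrom G f k S c ≡ just r → k < r
  rank-later (suc f) k S c p c-survives h =
    rank-≥ f (suc k) (step S) c (trans (sym (rank-survivor f k S c p c-survives)) h)

  survive : ∀ f k S c {r} → rankFrom G f k S c ≡ just r → k < r →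
            Σ ℕ λ f' → f ≡ suc f' × Proper S × ¬ T (isStrictCorner G S c)
  survive (suc f) k S c h k<r
    with isClique G S in clique | hasStrictCorner G S in corner | isStrictCorner G S c | h
  ... | true  | _     | _     | refl = contradiction k<r (<-irrefl refl)
  ... | false | true  | true  | refl = contradiction k<r (<-irrefl refl)
  ... | false | true  | false | _    =
    f , refl , record { notClique = subst T clique ; hasCorner = subst T (sym corner) _ } , λ ()

  ranked-corner : ∀ f k S c → rankFrom G f k S c ≡ just k → ¬ T (isClique G S) →
                  T (isStrictCorner G S c)
  ranked-corner f k S c h ncl with T? (isStrictCorner G S c) | T? (hasStrictCorner G S)
  ... | yes c-corner | _      = c-corner
  ... | no c-survives | yes hc =
    contradiction (rank-later f k S c (record { notClique = ncl ; hasCorner = hc }) c-survives h)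
                  (<-irrefl refl)
  ... | no _ | no nhc = contradiction (trans (sym h) (rank-stuck f k S c ncl nhc)) (λ ())

  -- The vertex set G^(j+1) remaining after j rounds.
  stage : ℕ → VSet (n G)
  stage zero    = λ _ → true
  stage (suc j) = step (stage j)

  -- The procedure reaches G[S] as the graph G^(k) with some fuel left, and x is
  -- still present: the rank of every vertex of S is computed from this point on.
  record Reached (k : ℕ) (S : VSet (n G)) (x : V) : Set where
    constructor reached
    field
      fuel   : ℕ
      agrees : ∀ c → T (S c) → rank G c ≡ rankFrom G fuel k S c
      member : T (S x)

  record Advance (k : ℕ) (S : VSet (n G)) (x : V) : Set where
    field
      proper       : Proper S
      corners-rank : ∀ c → T (isStrictCorner G S c) → rank G c ≡ just k
      next         : Reached (suc k) (step S) x

  advance : ∀ {k S x r} → Reached k S x → rank G x ≡ just r → k < r → Advance k S x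
  advance {k} {S} {x} (reached fuel agrees x∈S) hx k<r
    with survive fuel k S x (trans (sym (agrees x x∈S)) hx) k<r
  ... | f , refl , p , x-survives = record
    { proper       = p
    ; corners-rank = λ c c-corner →
        trans (agrees c (StrictlyCorners.c∈S (proj₂ (corner-sound S c c-corner))))
              (rank-corner f k S c p c-corner)
    ; next = reached f
        (λ c c∈ → trans (agrees c (step-⊆ S c∈)) (rank-survivor f k S c p (step-not-corner S c∈)))
        (step-survivor S x∈S x-survives) }

  reach : ∀ {x r} → rank G x ≡ just r → ∀ j → j < r → Reached (suc j) (stage j) x
  reach hx zero    _   = reached (n G) (λ _ _ → refl) _
  reach hx (suc j) j<r = Advance.next (advance (reach hx j (<-trans (n<1+n j) j<r)) hx j<r)

  -- A reached stage whose vertices all have rank at most its round is a clique: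
  -- otherwise a maximal dominator, which is no strict corner, would be ranked later.
  final-clique : ∀ {k S x} → Reached k S x → (∀ c → Σ ℕ λ r → rank G c ≡ just r × r ≤ k) →
                 T (isClique G S)
  final-clique {k} {S} {x} (reached f agrees x∈S) bounded
    with T? (isClique G S) | T? (hasStrictCorner G S)
  ... | yes cl  | _      = cl
  ... | no ncl | yes hc =
    let y , y∈S , _ , y-survives = maximal-dominator S x x∈S
        r , hy , r≤k = bounded y
    in contradiction r≤k (<⇒≱ (rank-later f k S y (record { notClique = ncl ; hasCorner = hc })
                                 y-survives (trans (sym (agrees y y∈S)) hy)))
  ... | no ncl | no nhc =
    let _ , hx , _ = bounded x
    in contradiction (trans (sym hx) (trans (agrees x x∈S) (rank-stuck f k S x ncl nhc))) (λ ())

  corner-of-rank : ∀ {k S c} → Reached k S c → rank G c ≡ just k → ¬ T (isClique G S) →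
                   T (isStrictCorner G S c)
  corner-of-rank {k} {S} {c} (reached f agrees c∈S) hc =
    ranked-corner f k S c (trans (sym (agrees c c∈S)) hc)

  rank-≤-cornerRank : ∀ c {r} → rank G c ≡ just r → r ≤ cornerRank G
  rank-≤-cornerRank c h =
    subst (λ m → finRank G m ≤ cornerRank G) h (fold-≥ vertices (∈-allFin c))
    where
    fold-≥ : ∀ xs {c} → c ∈ xs →
             finRank G (rank G c) ≤ foldr (λ v m → finRank G (rank G v) ⊔ m) 0 xs
    fold-≥ (x ∷ xs) (here refl) = m≤m⊔n _ _
    fold-≥ (x ∷ xs) (there c∈) = ≤-trans (fold-≥ xs c∈) (m≤n⊔m _ _)

  bounded-by-cornerRank : CopWin G → ∀ c → Σ ℕ λ r → rank G c ≡ just r × r ≤ cornerRank G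
  bounded-by-cornerRank cw c with rank G c in hc | cw c
  ... | just r | _ = r , refl , rank-≤-cornerRank c hc

  hasRank-sound : ∀ k v → T (hasRank G k v) → rank G v ≡ just k
  hasRank-sound k v t with rank G v
  ... | just j with j ≟ℕ k
  ...   | yes refl = refl
  hasRank-sound k v () | just j | no _
  hasRank-sound k v () | nothing

  hasRank-complete : ∀ k v → rank G v ≡ just k → T (hasRank G k v)
  hasRank-complete k v h with rank G v
  hasRank-complete k v refl | just j with j ≟ℕ j
  ... | yes _ = _
  ... | no j≢j = j≢j refl

  rank-witness : ∀ k → 1 ≤ rankCount G k → Σ V λ v → rank G v ≡ just k
  rank-witness k h =
    let v , t = filter-witness (λ v → T? (hasRank G k v)) vertices h
    in v , hasRank-sound k v t

  rank-unique : ∀ k → rankCount G k ≡ 1 →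
                ∀ {c c'} → rank G c ≡ just k → rank G c' ≡ just k → c ≡ c'
  rank-unique k h {c} {c'} hc hc' =
    filter-singleton (λ v → T? (hasRank G k v)) vertices h (∈-allFin c) (∈-allFin c')
      (hasRank-complete k c hc) (hasRank-complete k c' hc')

  -- Lemma 3.20 for a single cop-win graph of corner rank m+3: it cannot have a
  -- vertex x of rank m+3, a vertex y of rank m+2 and at most one vertex of
  -- rank m+1.  Following x through rounds m+1 and m+2 shows that H = G^(m+1)
  -- and G^(m+2) are proper and that the strict corners of H have rank m+1,
  -- so H has a unique one; G^(m+3) is a clique as no rank exceeds m+3; and y
  -- is a strict corner of G^(m+2).  This contradicts UniqueCorner.
  no-unique-corner-two-below-top : CopWin G → ∀ m → cornerRank G ≡ 3 + m →
    (Σ V λ x → rank G x ≡ just (3 + m)) → (Σ V λ y → rank G y ≡ just (2 + m)) →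
    (∀ {c c'} → rank G c ≡ just (1 + m) → rank G c' ≡ just (1 + m) → c ≡ c') → ⊥
  no-unique-corner-two-below-top cw m α≡ (x , hx) (y , hy) unique-rank =
    UniqueCorner.no-corner H v v-corner unique K-clique y y-corner
    where
    H : VSet (n G)
    H = stage m

    at-H : Advance (1 + m) H x
    at-H = advance (reach hx m (m<n+m m {3} (s≤s z≤n))) hx (m<n+m (1 + m) {2} (s≤s z≤n))

    at-H' : Advance (2 + m) (step H) x
    at-H' = advance (Advance.next at-H) hx (n<1+n (2 + m))

    K-clique : T (isClique G (step (step H)))
    K-clique = final-clique (Advance.next at-H')
      (subst (λ α → ∀ c → Σ ℕ λ r → rank G c ≡ just r × r ≤ α) α≡ (bounded-by-cornerRank cw))

    v : V
    v = proj₁ (has-corner-sound H (Proper.hasCorner (Advance.proper at-H)))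

    v-corner : T (isStrictCorner G H v)
    v-corner = proj₂ (has-corner-sound H (Proper.hasCorner (Advance.proper at-H)))

    unique : ∀ c → T (isStrictCorner G H c) → c ≡ v
    unique c c-corner =
      unique-rank (Advance.corners-rank at-H c c-corner) (Advance.corners-rank at-H v v-corner)

    y-corner : T (isStrictCorner G (step H) y)
    y-corner = corner-of-rank (reach hy (1 + m) (n<1+n (1 + m))) hy
                 (Proper.notClique (Advance.proper at-H'))

-- A vector map g (downFrom α) = (g (α-1), …, g 0) with at least three entries
-- has α = m+3 and begins with g (m+2), g (m+1), g m; for the rank cardinality
-- vector, g i = x_(i+1).
decode-vector : (g : ℕ → ℕ) (α : ℕ) {a b c : ℕ} {rest : List ℕ} →
                map g (downFrom α) ≡ a ∷ b ∷ c ∷ rest →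
                Σ ℕ λ m → α ≡ 3 + m × g (2 + m) ≡ a × g (1 + m) ≡ b × g m ≡ c
decode-vector g (suc (suc (suc m))) refl = m , refl , refl , refl , refl

lemma3p20 : (a b : ℕ) (rest : List ℕ) →
    All (1 ≤_) (a ∷ b ∷ 1 ∷ rest) → ¬ Realizable (a ∷ b ∷ 1 ∷ rest)
lemma3p20 a b rest (1≤a All.∷ 1≤b All.∷ _) (G , cw , vector≡)
  with m , α≡ , x₃≡a , x₂≡b , x₁≡1
         ← decode-vector (λ i → rankCount G (suc i)) (cornerRank G) vector≡ =
  no-unique-corner-two-below-top G cw m α≡
    (rank-witness G (3 + m) (subst (1 ≤_) (sym x₃≡a) 1≤a))
    (rank-witness G (2 + m) (subst (1 ≤_) (sym x₂≡b) 1≤b))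
    (rank-unique G (1 + m) x₁≡1)
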